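{- Let $R$ be a finite group and let $\varphi$ be an automorphism of $R$ with $|R:\mathrm{C}_R(\varphi)|=3$. Then one of the following holds: (1) $\frac14\left(|R|+|\mathbf{I}(R)|+|\mathrm{C}_R(\varphi)|+|\mathrm{C}_R(\varphi)^{ -1}|\right)\le \mathbf{c}(R)-\frac{|R|}{96}$; (2) $R$ is abelian of exponent greater than $2$ and $\varphi=\iota$, the inversion map $x\mapsto x^{ -1}$.
   Context: For a finite group $R$: $\mathbf{I}(R)=\{x\in R\mid x^2=1\}$, and $\mathbf{c}(R)=(|R|+|\mathbf{I}(R)|)/2$. For an automorphism $\varphi$: $\mathrm{C}_R(\varphi)=\{x\in R\mid x^\varphi=x\}$ and $\mathrm{C}_R(\varphi)^{ -1}=\{x\in R\mid x^\varphi=x^{ -1}\}$ (notation for the set of elements inverted by $\varphi$). $\iota$ denotes $x\mapsto x^{ -1}$. -}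

module Defs where

open import Data.Nat using (ℕ; _+_; _*_; _≤_)
open import Data.Fin using (Fin; _≟_)
open import Data.List using (length; filter; allFin)
open import Data.Product using (∃; _×_)
open import Relation.Nullary using (¬_; Dec)
open import Relation.Unary using (Pred; Decidable)
open import Relation.Binary.PropositionalEquality using (_≡_)
open import Function.Definitions using (Bijective)
open import Level using (0ℓ)

-- A finite group, presented (up to isomorphism) on the carrier Fin n
-- by its multiplication, identity and inverse, with the group axioms.
record FiniteGroup : Set where
  field
    n     : ℕ
    _∙_   : Fin n → Fin n → Fin n
    e     : Fin n
    inv   : Fin n → Fin n
    assoc : ∀ x y z → (x ∙ y) ∙ z ≡ x ∙ (y ∙ z)
    idˡ   : ∀ x → e ∙ x ≡ x
    idʳ   : ∀ x → x ∙ e ≡ x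
    invˡ  : ∀ x → inv x ∙ x ≡ e
    invʳ  : ∀ x → x ∙ inv x ≡ e

module _ (R : FiniteGroup) where
  open FiniteGroup R

  order : ℕ
  order = n

  count : {P : Pred (Fin n) 0ℓ} → Decidable P → ℕ
  count P? = length (filter P? (allFin n))

  record Automorphism : Set where
    field
      φ     : Fin n → Fin n
      hom   : ∀ x y → φ (x ∙ y) ≡ φ x ∙ φ y
      bij   : Bijective _≡_ _≡_ φ

  numInv : ℕ
  numInv = count (λ x → (x ∙ x) ≟ e)

  numFixed : Automorphism → ℕ
  numFixed α = count (λ x → Automorphism.φ α x ≟ x)

  -- |C_R(φ)^{-1}| = |{x | x^φ = x^{-1}}|
  numInverted : Automorphism → ℕ
  numInverted α = count (λ x → Automorphism.φ α x ≟ inv x)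

  IsAbelian : Set
  IsAbelian = ∀ x y → x ∙ y ≡ y ∙ x

  ExponentGt2 : Set
  ExponentGt2 = ∃ λ x → ¬ (x ∙ x ≡ e)

  IsInversion : Automorphism → Set
  IsInversion α = ∀ x → Automorphism.φ α x ≡ inv x

{-# OPTIONS --safe #-}

-- Write C(φ) for the fixed points, J for the inverted elements and X for the elements that are
-- neither. Since C(φ) ∩ J consists of involutions, |J| + |X| ≤ |I(R)| + |R ∖ C(φ)|, and with
-- |R| = 3|C(φ)| this gives (1) as soon as |C(φ)| ≤ 8|X|. Otherwise X is small. For x ∈ J ∖ C(φ)
-- and c ∈ C(φ), c x ∈ J iff conjugation by x inverts c, so this conjugation inverts all but |X|
-- elements of the subgroup C(φ), and hence all of it: a homomorphism inverting more than 3/4 of a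
-- group inverts the whole group. Then every y ∉ C(φ) lies in J (else C(φ) y ⊆ X), and for
-- x, y, x y ∉ C(φ) conjugation by x y inverts each c ∈ C(φ) but also fixes it, being the composite
-- of two inversions; so c = c⁻¹ and φ = ι. As inversion is then a homomorphism, R is abelian, and
-- x ∉ C(φ) has x² ≠ 1.
module Submission where

open import Defs
open import Algebra.Bundles using (Group)
import Algebra.Properties.Group as GroupProperties
import Algebra.Properties.Monoid as MonoidProperties
open import Data.Fin using (Fin; _≟_)
open import Data.List using (List; []; _∷_; length; filter; allFin; map)
open import Data.List.Properties using (length-removeAt′; length-map; length-tabulate; filter-none)
open import Data.List.Membership.Propositional using (_∈_)
open import Data.List.Membership.Propositional.Properties using (∈-filter⁺; ∈-allFin; ∈-map∘filter⁻)
open import Data.List.Relation.Binary.Subset.Propositional using () renaming (_⊆_ to _⊆ₗ_)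
open import Data.List.Relation.Binary.Sublist.Propositional using (⊆-refl)
open import Data.List.Relation.Binary.Sublist.Propositional.Properties using (filter⁺)
open import Data.List.Relation.Binary.Sublist.Heterogeneous.Properties using (length-mono-≤)
open import Data.List.Relation.Unary.All as All using (All; []; _∷_; all?)
open import Data.List.Relation.Unary.Any using (here; there; index; _─_)
open import Data.List.Relation.Unary.AllPairs using ([]; _∷_)
open import Data.List.Relation.Unary.Unique.Propositional using (Unique)
import Data.List.Relation.Unary.Unique.Propositional.Properties as Unique
open import Data.Nat using (ℕ; zero; suc; _+_; _*_; _≤_; _<_; z≤n; s≤s; z<s; _≤?_)
open import Data.Nat.Properties hiding (_≟_)
open import Data.Nat.Tactic.RingSolver using (solve-∀)
open import Data.Product using (∃; _×_; _,_; proj₂)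
open import Data.Sum using (_⊎_; inj₁; inj₂)
open import Function using (_∘_)
open import Function.Definitions using (Injective)
open import Level using (Level; 0ℓ)
open import Relation.Nullary using (¬_; yes; no; contradiction)
open import Relation.Nullary.Decidable using (decidable-stable)
open import Relation.Unary using (Pred; Decidable; ∁; _∩_)
open import Relation.Unary.Properties using (∁?; _∩?_; _∪?_)
open import Relation.Binary.PropositionalEquality

private
  variable
    a p q : Level
    A : Set a

positive-summand : ∀ {m g b} → m ≡ g + b → b < m → 0 < g
positive-summand {g = zero}  refl b<m = contradiction b<m (<-irrefl refl)
positive-summand {g = suc _} _    _   = z<s

module _ {P : Pred A p} (P? : Decidable P) where

  length-filter-∁ : ∀ xs → length (filter P? xs) + length (filter (∁? P?) xs) ≡ length xs
  length-filter-∁ [] = refl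
  length-filter-∁ (x ∷ xs) with P? x
  ... | yes _ = cong suc (length-filter-∁ xs)
  ... | no  _ = trans (+-suc _ _) (cong suc (length-filter-∁ xs))

  0<length-filter⇒∃ : ∀ xs → 0 < length (filter P? xs) → ∃ P
  0<length-filter⇒∃ (x ∷ xs) pos with P? x
  ... | yes px = x , px
  ... | no  _  = 0<length-filter⇒∃ xs pos

  module _ {Q : Pred A q} (Q? : Decidable Q) where

    length-filter-split : ∀ xs → length (filter P? xs) ≡ length (filter (P? ∩? Q?) xs) + length (filter (P? ∩? ∁? Q?) xs)
    length-filter-split [] = refl
    length-filter-split (x ∷ xs) with P? x | Q? x
    ... | yes _ | yes _ = cong suc (length-filter-split xs)
    ... | yes _ | no  _ = trans (cong suc (length-filter-split xs)) (sym (+-suc _ _))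
    ... | no  _ | _     = length-filter-split xs

    length-filter-∪ : ∀ xs → length (filter (P? ∪? Q?) xs) ≤ length (filter P? xs) + length (filter Q? xs)
    length-filter-∪ [] = z≤n
    length-filter-∪ (x ∷ xs) with P? x | Q? x
    ... | yes _ | yes _ = s≤s (≤-trans (length-filter-∪ xs) (+-monoʳ-≤ _ (n≤1+n _)))
    ... | yes _ | no  _ = s≤s (length-filter-∪ xs)
    ... | no  _ | yes _ = ≤-trans (s≤s (length-filter-∪ xs)) (≤-reflexive (sym (+-suc _ _)))
    ... | no  _ | no  _ = length-filter-∪ xs

    length-filter-mono : (∀ {x} → P x → Q x) → ∀ xs → length (filter P? xs) ≤ length (filter Q? xs)
    length-filter-mono P⊆Q xs = length-mono-≤ (filter⁺ P? Q? (λ { refl → P⊆Q }) (⊆-refl {x = xs}))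

∈-─⁺ : ∀ {x y : A} {ys} (x∈ys : x ∈ ys) → y ∈ ys → y ≢ x → y ∈ (ys ─ x∈ys)
∈-─⁺ (here refl) (here refl) y≢x = contradiction refl y≢x
∈-─⁺ (here refl) (there y∈ys) _  = y∈ys
∈-─⁺ (there _)  (here refl) _    = here refl
∈-─⁺ (there x∈ys) (there y∈ys) y≢x = there (∈-─⁺ x∈ys y∈ys y≢x)

unique-⊆⇒length≤ : ∀ {xs ys : List A} → Unique xs → xs ⊆ₗ ys → length xs ≤ length ys
unique-⊆⇒length≤ [] _ = z≤n
unique-⊆⇒length≤ {xs = x ∷ xs} {ys} (x∉xs ∷ xs-unique) xs⊆ys = begin
  suc (length xs)           ≤⟨ s≤s (unique-⊆⇒length≤ xs-unique xs⊆ys─x) ⟩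
  suc (length (ys ─ x∈ys))  ≡⟨ length-removeAt′ ys (index x∈ys) ⟨
  length ys                 ∎
  where
  open ≤-Reasoning
  x∈ys = xs⊆ys (here refl)
  xs⊆ys─x : xs ⊆ₗ (ys ─ x∈ys)
  xs⊆ys─x y∈xs = ∈-─⁺ x∈ys (xs⊆ys (there y∈xs)) (≢-sym (All.lookup x∉xs y∈xs))

module _ {n : ℕ} where

  ∣_∣ : {P : Pred (Fin n) p} → Decidable P → ℕ
  ∣ P? ∣ = length (filter P? (allFin n))

  count-injection : {P Q : Pred (Fin n) p} (P? : Decidable P) (Q? : Decidable Q) (f : Fin n → Fin n) →
    Injective _≡_ _≡_ f → (∀ {x} → P x → Q (f x)) → ∣ P? ∣ ≤ ∣ Q? ∣
  count-injection P? Q? f f-injective f-PQ = begin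
    ∣ P? ∣                             ≡⟨ length-map f (filter P? (allFin n)) ⟨
    length (map f (filter P? (allFin n))) ≤⟨ unique-⊆⇒length≤ image-unique image⊆ ⟩
    ∣ Q? ∣                             ∎
    where
    open ≤-Reasoning
    image-unique : Unique (map f (filter P? (allFin n)))
    image-unique = Unique.map⁺ f-injective (Unique.filter⁺ P? (Unique.allFin⁺ n))
    image⊆ : map f (filter P? (allFin n)) ⊆ₗ filter Q? (allFin n)
    image⊆ y∈ with ∈-map∘filter⁻ f P? {xs = allFin n} y∈
    ... | x , _ , refl , px = ∈-filter⁺ Q? (∈-allFin (f x)) (f-PQ px)

  SelfInjection : Pred (Fin n) p → (Fin n → Fin n) → Set p
  SelfInjection S f = Injective _≡_ _≡_ f × (∀ {b} → S b → S (f b))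

  SelfInjection-id : {S : Pred (Fin n) p} → SelfInjection S (λ b → b)
  SelfInjection-id = (λ eq → eq) , (λ sb → sb)

  SelfInjection-∘ : {S : Pred (Fin n) p} {f g : Fin n → Fin n} →
    SelfInjection S f → SelfInjection S g → SelfInjection S (f ∘ g)
  SelfInjection-∘ (f-injective , f-S) (g-injective , g-S) = g-injective ∘ f-injective , f-S ∘ g-S

  module _ {S T : Pred (Fin n) p} (S? : Decidable S) (T? : Decidable T) where

    private
      AllT : List (Fin n → Fin n) → Pred (Fin n) p
      AllT fs b = All (λ f → T (f b)) fs

      AllT? : ∀ fs → Decidable (AllT fs)
      AllT? fs b = all? (λ f → T? (f b)) fs

    -- Each self-injection f of S moves at most ∣ S ∖ T ∣ points of S outside T.
    failures-bound : ∀ {fs} → All (SelfInjection S) fs →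
      ∣ S? ∩? ∁? (AllT? fs) ∣ ≤ length fs * ∣ S? ∩? ∁? T? ∣
    failures-bound [] =
      ≤-reflexive (cong length (filter-none (S? ∩? ∁? (AllT? [])) (All.universal (λ _ (_ , ¬all) → ¬all []) (allFin n))))
    failures-bound {f ∷ fs} ((f-injective , f-S) ∷ fs-S) = begin
      ∣ S? ∩? ∁? (AllT? (f ∷ fs)) ∣                      ≤⟨ length-filter-mono _ _ failure-cases (allFin n) ⟩
      ∣ (S? ∩? ∁? (T? ∘ f)) ∪? (S? ∩? ∁? (AllT? fs)) ∣  ≤⟨ length-filter-∪ _ _ (allFin n) ⟩
      ∣ S? ∩? ∁? (T? ∘ f) ∣ + ∣ S? ∩? ∁? (AllT? fs) ∣   ≤⟨ +-mono-≤ f-failures (failures-bound fs-S) ⟩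
      ∣ S? ∩? ∁? T? ∣ + length fs * ∣ S? ∩? ∁? T? ∣      ∎
      where
      open ≤-Reasoning
      failure-cases : ∀ {b} → S b × ¬ AllT (f ∷ fs) b → (S b × ¬ T (f b)) ⊎ (S b × ¬ AllT fs b)
      failure-cases {b} (sb , ¬all) with T? (f b)
      ... | yes t = inj₂ (sb , ¬all ∘ (t ∷_))
      ... | no ¬t = inj₁ (sb , ¬t)
      f-failures : ∣ S? ∩? ∁? (T? ∘ f) ∣ ≤ ∣ S? ∩? ∁? T? ∣
      f-failures = count-injection _ _ f f-injective (λ (sb , ¬t) → f-S sb , ¬t)

    common-point : ∀ {fs} → All (SelfInjection S) fs → length fs * ∣ S? ∩? ∁? T? ∣ < ∣ S? ∣ →
      ∃ λ b → S b × All (λ f → T (f b)) fs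
    common-point {fs} fs-S few-failures = 0<length-filter⇒∃ (S? ∩? AllT? fs) (allFin n)
      (positive-summand (length-filter-split S? (AllT? fs) (allFin n)) (≤-<-trans (failures-bound fs-S) few-failures))

group : FiniteGroup → Group 0ℓ 0ℓ
group R = record
  { Carrier = Fin n ; _≈_ = _≡_ ; _∙_ = _∙_ ; ε = e ; _⁻¹ = inv
  ; isGroup = record
    { isMonoid = record
      { isSemigroup = record { isMagma = record { isEquivalence = isEquivalence ; ∙-cong = cong₂ _∙_ } ; assoc = assoc }
      ; identity = idˡ , idʳ }
    ; inverse = invˡ , invʳ
    ; ⁻¹-cong = cong inv } }
  where open FiniteGroup R

module _ (R : FiniteGroup) where
  open FiniteGroup R
  open GroupProperties (group R)
    using (∙-cancelˡ; ∙-cancelʳ; ⁻¹-involutive; ⁻¹-injective; ⁻¹-anti-homo-∙; inverseʳ-unique)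
  open MonoidProperties (Group.monoid (group R)) using (cancelˡ)
  open ≡-Reasoning

  Inverts : (Fin n → Fin n) → Pred (Fin n) 0ℓ
  Inverts κ c = κ c ≡ inv c

  Inverts? : ∀ κ → Decidable (Inverts κ)
  Inverts? κ c = κ c ≟ inv c

  module _ {κ : Fin n → Fin n} (κ-homo : ∀ a b → κ (a ∙ b) ≡ κ a ∙ κ b) where

    inverts-∙⇒comm : ∀ {a b} → Inverts κ a → Inverts κ b → Inverts κ (a ∙ b) → a ∙ b ≡ b ∙ a
    inverts-∙⇒comm {a} {b} κa κb κab = ⁻¹-injective (begin
      inv (a ∙ b)    ≡⟨ κab ⟨
      κ (a ∙ b)      ≡⟨ κ-homo a b ⟩
      κ a ∙ κ b      ≡⟨ cong₂ _∙_ κa κb ⟩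
      inv a ∙ inv b  ≡⟨ ⁻¹-anti-homo-∙ b a ⟨
      inv (b ∙ a)    ∎)

    module _ {S : Pred (Fin n) 0ℓ} (S? : Decidable S)
             (S-∙ : ∀ {a b} → S a → S b → S (a ∙ b)) (S-inv : ∀ {a} → S a → S (inv a))
             (mostly-inverted : 4 * ∣ S? ∩? ∁? (Inverts? κ) ∣ < ∣ S? ∣) where

      private
        left-translation : ∀ {a} → S a → SelfInjection S (a ∙_)
        left-translation {a} sa = ∙-cancelˡ a _ _ , S-∙ sa

        reflection : ∀ {d} → S d → SelfInjection S (λ b → inv b ∙ d)
        reflection {d} sd = ⁻¹-injective ∘ ∙-cancelʳ d _ _ , λ sb → S-∙ (S-inv sb) sd

      -- a and d commute because a commutes with both b and b⁻¹d for a suitable b.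
      inverted-central : ∀ {a d} → S a → Inverts κ a → S d → a ∙ d ≡ d ∙ a
      inverted-central {a} {d} sa κa sd
        with common-point S? (Inverts? κ)
               (SelfInjection-id ∷ left-translation sa ∷ reflection sd ∷
                SelfInjection-∘ (left-translation sa) (reflection sd) ∷ [])
               mostly-inverted
      ... | b , _ , κb ∷ κab ∷ κs ∷ κas ∷ [] = begin
        a ∙ d        ≡⟨ cong (a ∙_) (cancelˡ (invʳ b) d) ⟨
        a ∙ (b ∙ s)  ≡⟨ assoc a b s ⟨
        (a ∙ b) ∙ s  ≡⟨ cong (_∙ s) (inverts-∙⇒comm κa κb κab) ⟩
        (b ∙ a) ∙ s  ≡⟨ assoc b a s ⟩
        b ∙ (a ∙ s)  ≡⟨ cong (b ∙_) (inverts-∙⇒comm κa κs κas) ⟩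
        b ∙ (s ∙ a)  ≡⟨ assoc b s a ⟨
        (b ∙ s) ∙ a  ≡⟨ cong (_∙ a) (cancelˡ (invʳ b) d) ⟩
        d ∙ a        ∎
        where
        s : Fin n
        s = inv b ∙ d

      inverts-all : ∀ {c} → S c → Inverts κ c
      inverts-all {c} sc
        with common-point S? (Inverts? κ) (SelfInjection-id ∷ reflection sc ∷ [])
               (≤-<-trans (*-monoˡ-≤ ∣ S? ∩? ∁? (Inverts? κ) ∣ (m≤m+n 2 2)) mostly-inverted)
      ... | t , st , κt ∷ κs ∷ [] = begin
        κ c                  ≡⟨ cong κ (cancelˡ (invʳ t) c) ⟨
        κ (t ∙ s)            ≡⟨ κ-homo t s ⟩
        κ t ∙ κ s            ≡⟨ cong₂ _∙_ κt κs ⟩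
        inv t ∙ inv s        ≡⟨ cong (inv t ∙_) inv-s ⟩
        inv t ∙ (inv c ∙ t)  ≡⟨ cong (inv t ∙_) (inverted-central st κt (S-inv sc)) ⟨
        inv t ∙ (t ∙ inv c)  ≡⟨ cancelˡ (invˡ t) (inv c) ⟩
        inv c                ∎
        where
        s : Fin n
        s = inv t ∙ c
        inv-s : inv s ≡ inv c ∙ t
        inv-s = trans (⁻¹-anti-homo-∙ (inv t) c) (cong (inv c ∙_) (⁻¹-involutive t))

  conj : Fin n → Fin n → Fin n
  conj x c = x ∙ (c ∙ inv x)

  conj-homo : ∀ x a b → conj x (a ∙ b) ≡ conj x a ∙ conj x b
  conj-homo x a b = begin
    x ∙ ((a ∙ b) ∙ inv x)                  ≡⟨ cong (x ∙_) (assoc a b (inv x)) ⟩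
    x ∙ (a ∙ (b ∙ inv x))                  ≡⟨ cong (λ w → x ∙ (a ∙ w)) (cancelˡ (invˡ x) (b ∙ inv x)) ⟨
    x ∙ (a ∙ (inv x ∙ (x ∙ (b ∙ inv x))))  ≡⟨ cong (x ∙_) (assoc a (inv x) (x ∙ (b ∙ inv x))) ⟨
    x ∙ ((a ∙ inv x) ∙ (x ∙ (b ∙ inv x)))  ≡⟨ assoc x (a ∙ inv x) (x ∙ (b ∙ inv x)) ⟨
    conj x a ∙ conj x b                    ∎

  conj-∙ : ∀ x y c → conj (x ∙ y) c ≡ conj x (conj y c)
  conj-∙ x y c = begin
    (x ∙ y) ∙ (c ∙ inv (x ∙ y))      ≡⟨ cong (λ w → (x ∙ y) ∙ (c ∙ w)) (⁻¹-anti-homo-∙ x y) ⟩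
    (x ∙ y) ∙ (c ∙ (inv y ∙ inv x))  ≡⟨ assoc x y (c ∙ (inv y ∙ inv x)) ⟩
    x ∙ (y ∙ (c ∙ (inv y ∙ inv x)))  ≡⟨ cong (λ w → x ∙ (y ∙ w)) (assoc c (inv y) (inv x)) ⟨
    x ∙ (y ∙ ((c ∙ inv y) ∙ inv x))  ≡⟨ cong (x ∙_) (assoc y (c ∙ inv y) (inv x)) ⟨
    x ∙ ((y ∙ (c ∙ inv y)) ∙ inv x)  ∎

  module _ (α : Automorphism R) where
    open Automorphism α

    Fixed : Pred (Fin n) 0ℓ
    Fixed c = φ c ≡ c

    Fixed? : Decidable Fixed
    Fixed? c = φ c ≟ c

    Exceptional? : Decidable (∁ Fixed ∩ ∁ (Inverts φ))
    Exceptional? = ∁? Fixed? ∩? ∁? (Inverts? φ)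

    φ-ε : φ e ≡ e
    φ-ε = ∙-cancelˡ (φ e) (φ e) e (begin
      φ e ∙ φ e  ≡⟨ hom e e ⟨
      φ (e ∙ e)  ≡⟨ cong φ (idˡ e) ⟩
      φ e        ≡⟨ idʳ (φ e) ⟨
      φ e ∙ e    ∎)

    φ-inv : ∀ x → φ (inv x) ≡ inv (φ x)
    φ-inv x = inverseʳ-unique (φ x) (φ (inv x)) (begin
      φ x ∙ φ (inv x)  ≡⟨ hom x (inv x) ⟨
      φ (x ∙ inv x)    ≡⟨ cong φ (invʳ x) ⟩
      φ e              ≡⟨ φ-ε ⟩
      e                ∎)

    Fixed-∙ : ∀ {a b} → Fixed a → Fixed b → Fixed (a ∙ b)
    Fixed-∙ {a} {b} fa fb = trans (hom a b) (cong₂ _∙_ fa fb)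

    Fixed-inv : ∀ {a} → Fixed a → Fixed (inv a)
    Fixed-inv {a} fa = trans (φ-inv a) (cong inv fa)

    Fixed-∙-cancelˡ : ∀ {c x} → Fixed c → Fixed (c ∙ x) → Fixed x
    Fixed-∙-cancelˡ {c} {x} fc fcx = ∙-cancelˡ c (φ x) x (begin
      c ∙ φ x    ≡⟨ cong (_∙ φ x) fc ⟨
      φ c ∙ φ x  ≡⟨ hom c x ⟨
      φ (c ∙ x)  ≡⟨ fcx ⟩
      c ∙ x      ∎)

    module _ {c x} (fc : Fixed c) (jx : Inverts φ x) where

      φ-∙-inverted : φ (c ∙ x) ≡ c ∙ inv x
      φ-∙-inverted = trans (hom c x) (cong₂ _∙_ fc jx)

      inverted-∙⇒conj-inverts : Inverts φ (c ∙ x) → Inverts (conj x) c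
      inverted-∙⇒conj-inverts jcx = begin
        x ∙ (c ∙ inv x)      ≡⟨ cong (x ∙_) (trans (sym φ-∙-inverted) (trans jcx (⁻¹-anti-homo-∙ c x))) ⟩
        x ∙ (inv x ∙ inv c)  ≡⟨ cancelˡ (invʳ x) (inv c) ⟩
        inv c                ∎

      conj-inverts⇒inverted-∙ : Inverts (conj x) c → Inverts φ (c ∙ x)
      conj-inverts⇒inverted-∙ κc = begin
        φ (c ∙ x)         ≡⟨ φ-∙-inverted ⟩
        c ∙ inv x         ≡⟨ cancelˡ (invˡ x) (c ∙ inv x) ⟨
        inv x ∙ conj x c  ≡⟨ cong (inv x ∙_) κc ⟩
        inv x ∙ inv c     ≡⟨ ⁻¹-anti-homo-∙ c x ⟨
        inv (c ∙ x)       ∎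

    fixed+nonfixed : ∣ Fixed? ∣ + ∣ ∁? Fixed? ∣ ≡ n
    fixed+nonfixed = trans (length-filter-∁ Fixed? (allFin n)) (length-tabulate (λ x → x))

    module _ (few-exceptional : 4 * ∣ Exceptional? ∣ < ∣ Fixed? ∣) where

      conj-inverts-fixed : ∀ {x} → Inverts φ x → ¬ Fixed x → ∀ {c} → Fixed c → Inverts (conj x) c
      conj-inverts-fixed {x} jx ¬fx =
        inverts-all (conj-homo x) Fixed? Fixed-∙ Fixed-inv (≤-<-trans (*-monoʳ-≤ 4 defect≤exceptional) few-exceptional)
        where
        defect≤exceptional : ∣ Fixed? ∩? ∁? (Inverts? (conj x)) ∣ ≤ ∣ Exceptional? ∣
        defect≤exceptional = count-injection _ _ (_∙ x) (∙-cancelʳ x _ _)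
          (λ (fc , ¬κc) → ¬fx ∘ Fixed-∙-cancelˡ fc , ¬κc ∘ inverted-∙⇒conj-inverts fc jx)

      -- Otherwise y would multiply all of C(φ) into the exceptional elements.
      nonfixed-inverted : ∀ {y} → ¬ Fixed y → Inverts φ y
      nonfixed-inverted {y} ¬fy = decidable-stable (Inverts? φ y) λ ¬jy →
        <⇒≱ (≤-<-trans (m≤m+n _ _) few-exceptional)
          (count-injection Fixed? Exceptional? (_∙ y) (∙-cancelʳ y _ _) (λ fc → ¬fcy fc , ¬jcy ¬jy fc))
        where
        ¬fcy : ∀ {c} → Fixed c → ¬ Fixed (c ∙ y)
        ¬fcy fc = ¬fy ∘ Fixed-∙-cancelˡ fc
        ¬jcy : ¬ Inverts φ y → ∀ {c} → Fixed c → ¬ Inverts φ (c ∙ y)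
        ¬jcy ¬jy {c} fc jcy = ¬jy (subst (Inverts φ) (cancelˡ (invˡ c) y)
          (conj-inverts⇒inverted-∙ (Fixed-inv fc) jcy (conj-inverts-fixed jcy (¬fcy fc) (Fixed-inv fc))))

      module _ (index>2 : 2 * ∣ Fixed? ∣ < n) where

        fixed<nonfixed : ∣ Fixed? ∣ < ∣ ∁? Fixed? ∣
        fixed<nonfixed = +-cancelˡ-< ∣ Fixed? ∣ _ _
          (subst₂ _<_ (cong (∣ Fixed? ∣ +_) (+-identityʳ ∣ Fixed? ∣)) (sym fixed+nonfixed) index>2)

        -- At most ∣ C(φ) ∣ elements y have x y ∈ C(φ), fewer than there are non-fixed y.
        nonfixed-partner : ∀ x → ∃ λ y → ¬ Fixed y × ¬ Fixed (x ∙ y)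
        nonfixed-partner x = 0<length-filter⇒∃ (∁? Fixed? ∩? ∁? Fixed-x∙?) (allFin n)
          (positive-summand
            (trans (length-filter-split (∁? Fixed?) Fixed-x∙? (allFin n)) (+-comm ∣ ∁? Fixed? ∩? Fixed-x∙? ∣ _))
            (≤-<-trans fixed-partners≤fixed fixed<nonfixed))
          where
          Fixed-x∙? : Decidable (λ y → Fixed (x ∙ y))
          Fixed-x∙? y = Fixed? (x ∙ y)
          fixed-partners≤fixed : ∣ ∁? Fixed? ∩? Fixed-x∙? ∣ ≤ ∣ Fixed? ∣
          fixed-partners≤fixed = count-injection _ _ (x ∙_) (∙-cancelˡ x _ _) proj₂

        nonfixed-pair : ∃ λ x → ∃ λ y → ¬ Fixed x × ¬ Fixed y × ¬ Fixed (x ∙ y)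
        nonfixed-pair with 0<length-filter⇒∃ (∁? Fixed?) (allFin n) (≤-<-trans z≤n fixed<nonfixed)
        ... | x , ¬fx with nonfixed-partner x
        ...   | y , ¬fy , ¬fxy = x , y , ¬fx , ¬fy , ¬fxy

        fixed-inverted : ∀ {c} → Fixed c → Inverts φ c
        fixed-inverted {c} fc = trans fc (sym c⁻¹≡c)
          where
          conj-inverts : ∀ {z} → ¬ Fixed z → ∀ {c} → Fixed c → Inverts (conj z) c
          conj-inverts ¬fz = conj-inverts-fixed (nonfixed-inverted ¬fz) ¬fz
          c⁻¹≡c : inv c ≡ c
          c⁻¹≡c with nonfixed-pair
          ... | x , y , ¬fx , ¬fy , ¬fxy = begin
            inv c              ≡⟨ conj-inverts ¬fxy fc ⟨
            conj (x ∙ y) c     ≡⟨ conj-∙ x y c ⟩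
            conj x (conj y c)  ≡⟨ cong (conj x) (conj-inverts ¬fy fc) ⟩
            conj x (inv c)     ≡⟨ conj-inverts ¬fx (Fixed-inv fc) ⟩
            inv (inv c)        ≡⟨ ⁻¹-involutive c ⟩
            c                  ∎

        φ-inversion : IsInversion R α
        φ-inversion x with Fixed? x
        ... | yes fx = fixed-inverted fx
        ... | no ¬fx = nonfixed-inverted ¬fx

        abelian-inversion : IsAbelian R × ExponentGt2 R × IsInversion R α
        abelian-inversion = abelian , exponent>2 , φ-inversion
          where
          abelian : IsAbelian R
          abelian a b = inverts-∙⇒comm hom (φ-inversion a) (φ-inversion b) (φ-inversion (a ∙ b))
          exponent>2 : ExponentGt2 R
          exponent>2 with nonfixed-pair
          ... | x , _ , ¬fx , _ = x , λ x²≡e → ¬fx (trans (φ-inversion x) (sym (inverseʳ-unique x x x²≡e)))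

module _ (R : FiniteGroup) (α : Automorphism R) where
  open FiniteGroup R
  open Automorphism α
  open ≤-Reasoning

  private
    F? : Decidable (Fixed R α)
    F? = Fixed? R α
    J? : Decidable (Inverts R φ)
    J? = Inverts? R φ

  inverted+exceptional≤ : ∣ J? ∣ + ∣ Exceptional? R α ∣ ≤ numInv R + ∣ ∁? F? ∣
  inverted+exceptional≤ = begin
    ∣ J? ∣ + X                             ≡⟨ cong (_+ X) (length-filter-split J? F? (allFin n)) ⟩
    ∣ J? ∩? F? ∣ + ∣ J? ∩? ∁? F? ∣ + X      ≡⟨ +-assoc ∣ J? ∩? F? ∣ _ X ⟩
    ∣ J? ∩? F? ∣ + (∣ J? ∩? ∁? F? ∣ + X)    ≤⟨ +-mono-≤ fixed-inverted-involutions (+-monoˡ-≤ X nonfixed-inverted≤) ⟩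
    numInv R + (∣ ∁? F? ∩? J? ∣ + X)       ≡⟨ cong (numInv R +_) (length-filter-split (∁? F?) J? (allFin n)) ⟨
    numInv R + ∣ ∁? F? ∣                   ∎
    where
    X : ℕ
    X = ∣ Exceptional? R α ∣
    fixed-inverted-involutions : ∣ J? ∩? F? ∣ ≤ numInv R
    fixed-inverted-involutions =
      length-filter-mono _ _ (λ {c} (jc , fc) → trans (cong (c ∙_) (trans (sym fc) jc)) (invʳ c)) (allFin n)
    nonfixed-inverted≤ : ∣ J? ∩? ∁? F? ∣ ≤ ∣ ∁? F? ∩? J? ∣
    nonfixed-inverted≤ = length-filter-mono _ _ (λ (jc , ¬fc) → ¬fc , jc) (allFin n)

index-three-bound : ∀ {N C M I J X} → N ≡ 3 * C → C + M ≡ N → J + X ≤ I + M → C ≤ 8 * X →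
  24 * (N + I + C + J) + N ≤ 48 * (N + I)
index-three-bound {C = C} {M} {I} {J} {X} refl C+M≡3C J+X≤I+M C≤8X = +-cancelʳ-≤ (24 * X) _ _ (begin
  24 * (3 * C + I + C + J) + 3 * C + 24 * X          ≡⟨ regroup C I J X ⟩
  24 * (4 * C + I) + 24 * (J + X) + 3 * C            ≤⟨ +-mono-≤ (+-monoʳ-≤ (24 * (4 * C + I)) (*-monoʳ-≤ 24 J+X≤I+2C)) (*-monoʳ-≤ 3 C≤8X) ⟩
  24 * (4 * C + I) + 24 * (I + 2 * C) + 3 * (8 * X)  ≡⟨ collect C I X ⟩
  48 * (3 * C + I) + 24 * X                          ∎)
  where
  open ≤-Reasoning
  J+X≤I+2C : J + X ≤ I + 2 * C
  J+X≤I+2C = subst (λ m → J + X ≤ I + m) (+-cancelˡ-≡ C M (2 * C) C+M≡3C) J+X≤I+M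
  regroup : ∀ C I J X → 24 * (3 * C + I + C + J) + 3 * C + 24 * X ≡ 24 * (4 * C + I) + 24 * (J + X) + 3 * C
  regroup = solve-∀
  collect : ∀ C I X → 24 * (4 * C + I) + 24 * (I + 2 * C) + 3 * (8 * X) ≡ 48 * (3 * C + I) + 24 * X
  collect = solve-∀

lemma2p6 : (R : FiniteGroup) (α : Automorphism R) →
    order R ≡ 3 * numFixed R α →
    (24 * (order R + numInv R + numFixed R α + numInverted R α) + order R
        ≤ 48 * (order R + numInv R))
    ⊎ (IsAbelian R × ExponentGt2 R × IsInversion R α)
lemma2p6 R α index with 24 * (order R + numInv R + numFixed R α + numInverted R α) + order R ≤? 48 * (order R + numInv R)
... | yes bound  = inj₁ bound
... | no  ¬bound = inj₂ (abelian-inversion R α few-exceptional index>2)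
  where
  C X : ℕ
  C = numFixed R α
  X = ∣ Exceptional? R α ∣
  8X<C : 8 * X < C
  8X<C = ≰⇒> (¬bound ∘ index-three-bound index (fixed+nonfixed R α) (inverted+exceptional≤ R α))
  few-exceptional : 4 * X < C
  few-exceptional = ≤-<-trans (*-monoˡ-≤ X (m≤m+n 4 4)) 8X<C
  index>2 : 2 * C < order R
  index>2 = subst (2 * C <_) (sym index) (m<n+m (2 * C) (≤-<-trans z≤n 8X<C))
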